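{- There exists a finite colouring of $\mathbb{N}$ such that there is no monochromatic pair $\{a,a^{b^b}\}$ with $a=2^s$, $b=2^t$ for some $s,t\in\mathbb{N}$.
   Context: $\mathbb{N}=\{1,2,\ldots\}$. A finite colouring is a function from $\mathbb{N}$ to a finite set; a pair is monochromatic if both elements receive the same colour. -}

module Defs where

open import Data.Nat using (ℕ; _≤_; _^_)
open import Data.Fin using (Fin)
open import Relation.Binary.PropositionalEquality using (_≡_)
open import Relation.Nullary using (¬_)

-- A finite colouring with k colours. The paper's ℕ = {1,2,...}; the
-- value at 0 is irrelevant (only powers of 2 with exponent ≥ 1 are coloured).
Colouring : ℕ → Set
Colouring k = ℕ → Fin k

Monochromatic : {k : ℕ} → Colouring k → ℕ → ℕ → Set
Monochromatic c x y = c x ≡ c y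

NoMonoPowerPair : {k : ℕ} → Colouring k → Set
NoMonoPowerPair c = ∀ (s t : ℕ) → 1 ≤ s → 1 ≤ t →
  ¬ Monochromatic c (2 ^ s) ((2 ^ s) ^ ((2 ^ t) ^ (2 ^ t)))

-- With a = 2^s and b = 2^t, ⌊log₂ ⌊log₂ a⌋⌋ and ⌊log₂ ⌊log₂ a^(b^b)⌋⌋
-- differ by exactly t·2^t, so it suffices to colour ℕ so that no two numbers
-- at distance t·2^t (t ≥ 1) get the same colour.  Split by t mod 4, these
-- distances form four sequences E growing by a factor ≥ 10.  For such E there
-- is, by nested intervals, an α with every E i · α at distance ≥ 1/3 from ℤ,
-- and then n ↦ ⌊4nα⌋ mod 4 separates n from n + E i, because
-- 4 E i · α mod 4 lies in [4/3, 8/3].  The product of the four colourings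
-- uses 4^4 colours.
module Submission where

open import Defs

open import Data.Nat
open import Data.Nat.Properties
open import Algebra.Properties.CommutativeSemigroup *-commutativeSemigroup
  using (xy∙z≈xz∙y; x∙yz≈y∙xz)
open import Data.Nat.DivMod
open import Data.Nat.Divisibility using (_∣_; divides; n∣m*n; ∣m+n∣m⇒∣n; ∣⇒≤)
open import Data.Nat.Tactic.RingSolver using (solve-∀)
open import Data.Product using (Σ; ∃; ∃₂; _×_; _,_; proj₁; proj₂)
open import Relation.Binary.PropositionalEquality
open import Relation.Nullary using (¬_)
open import Data.Fin using (Fin; toℕ; funToFin; finToFun)
open import Data.Fin.Properties using (toℕ-fromℕ<; finToFun-funToFin)
open import Data.Nat.Logarithm using (⌊log₂_⌋; ⌊log₂[2^n]⌋≡n; ⌊log₂[2*b]⌋≡1+⌊log₂b⌋)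
open ≤-Reasoning

-- (a , p) stands for a / p.  The order is cross-multiplication, which only
-- behaves as an order for non-zero denominators, hence the NonZero arguments.
Frac : Set
Frac = ℕ × ℕ

infix 4 _≼_ _≺_ _∈_ _⊆_

data _≼_ : Frac → Frac → Set where
  *≤* : ∀ {a p b q} → a * q ≤ b * p → (a , p) ≼ (b , q)

data _≺_ : Frac → Frac → Set where
  *<* : ∀ {a p b q} → a * q < b * p → (a , p) ≺ (b , q)

≼-refl : ∀ {x} → x ≼ x
≼-refl = *≤* ≤-refl

≼-trans : ∀ {x b q z} .{{_ : NonZero q}} → x ≼ (b , q) → (b , q) ≼ z → x ≼ z
≼-trans {a , p} {b} {q} {c , r} (*≤* a≼b) (*≤* b≼c) =
  *≤* (*-cancelʳ-≤ (a * r) (c * p) q (begin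
    a * r * q ≡⟨ xy∙z≈xz∙y a r q ⟩
    a * q * r ≤⟨ *-monoˡ-≤ r a≼b ⟩
    b * p * r ≡⟨ xy∙z≈xz∙y b p r ⟩
    b * r * p ≤⟨ *-monoˡ-≤ p b≼c ⟩
    c * q * p ≡⟨ xy∙z≈xz∙y c q p ⟩
    c * p * q ∎))

≼-≺-trans : ∀ {a p b q z} .{{_ : NonZero p}} .{{_ : NonZero q}} →
            (a , p) ≼ (b , q) → (b , q) ≺ z → (a , p) ≺ z
≼-≺-trans {a} {p} {b} {q} {c , r} (*≤* a≼b) (*<* b≺c) =
  *<* (*-cancelʳ-< q (a * r) (c * p) (begin-strict
    a * r * q ≡⟨ xy∙z≈xz∙y a r q ⟩
    a * q * r ≤⟨ *-monoˡ-≤ r a≼b ⟩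
    b * p * r ≡⟨ xy∙z≈xz∙y b p r ⟩
    b * r * p <⟨ *-monoˡ-< p b≺c ⟩
    c * q * p ≡⟨ xy∙z≈xz∙y c q p ⟩
    c * p * q ∎))

≼-scale : ∀ c {a p b q} → (a , p) ≼ (b , q) → (c * a , p) ≼ (c * b , q)
≼-scale c {a} {p} {b} {q} (*≤* a≼b) = *≤* (begin
  c * a * q   ≡⟨ *-assoc c a q ⟩
  c * (a * q) ≤⟨ *-monoʳ-≤ c a≼b ⟩
  c * (b * p) ≡⟨ *-assoc c b p ⟨
  c * b * p   ∎)

[m/n+1]*n>m : ∀ m n .{{_ : NonZero n}} → m < suc (m / n) * n
[m/n+1]*n>m m n = begin-strict
  m                 ≡⟨ m≡m%n+[m/n]*n m n ⟩
  m % n + m / n * n <⟨ +-monoˡ-< (m / n * n) (m%n<n m n) ⟩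
  suc (m / n) * n   ∎

≼-ceiling : ∀ a p e .{{_ : NonZero p}} → (a , p) ≼ (suc (a * e / p) , e)
≼-ceiling a p e = *≤* (<⇒≤ ([m/n+1]*n>m (a * e) p))

Interval : Set
Interval = Frac × Frac

_∈_ : Frac → Interval → Set
x ∈ (l , h) = l ≼ x × x ≼ h

_⊆_ : Interval → Interval → Set
(l , h) ⊆ (l′ , h′) = l′ ≼ l × h ≼ h′

cell : ℕ → ℕ → Interval
cell a p = (a , p) , (suc a , p)

lower∈cell : ∀ a p → (a , p) ∈ cell a p
lower∈cell a p = ≼-refl , *≤* (*-monoˡ-≤ p (n≤1+n a))

∈-⊆ : ∀ {x a p J} .{{_ : NonZero p}} → x ∈ cell a p → cell a p ⊆ J → x ∈ J
∈-⊆ (l≼x , x≼h) (l′≼l , h≼h′) = ≼-trans l′≼l l≼x , ≼-trans x≼h h≼h′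

⊆-refl : ∀ {I} → I ⊆ I
⊆-refl = ≼-refl , ≼-refl

⊆-trans : ∀ {I a p J} .{{_ : NonZero p}} → I ⊆ cell a p → cell a p ⊆ J → I ⊆ J
⊆-trans (l′≼l , h≼h′) (l″≼l′ , h′≼h″) = ≼-trans l″≼l′ l′≼l , ≼-trans h≼h′ h′≼h″

≼-ceiling-succ : ∀ b c q .{{_ : NonZero c}} → 2 * c ≤ q →
                 (suc (suc (b * q / c)) , q) ≼ (suc b , c)
≼-ceiling-succ b c q q≥2c = *≤* (begin
  c + (c + n * c) ≡⟨ regroup n c ⟩
  n * c + 2 * c   ≤⟨ +-mono-≤ (m/n*n≤m (b * q) c) q≥2c ⟩
  b * q + q       ≡⟨ +-comm (b * q) q ⟩
  suc b * q       ∎)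
  where
  n : ℕ
  n = b * q / c
  regroup : ∀ n c → c + (c + n * c) ≡ n * c + 2 * c
  regroup = solve-∀

-- The x for which e · x lies in the middle third [k + 1/3, k + 2/3] of [k, k + 1].
middleThird : ℕ → ℕ → Interval
middleThird k e = (1 + 3 * k , 3 * e) , (2 + 3 * k , 3 * e)

record Refinement (a p e p′ : ℕ) : Set where
  field
    num    : ℕ
    integerPart  : ℕ
    nested : cell num p′ ⊆ cell a p
    middle : cell num p′ ⊆ middleThird integerPart e

-- 5p ≤ 3e makes the cell [a/p, (a+1)/p] long enough to contain a whole
-- middle third of scale 1/e, and 6e ≤ p′ makes cells of width 1/p′ short
-- enough to fit inside one.
refine : ∀ a p e p′ .{{_ : NonZero p}} .{{_ : NonZero e}} →
         6 * e ≤ p′ → 5 * p ≤ 3 * e → Refinement a p e p′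
refine a p e p′ p′≥6e 3e≥5p = record
  { num    = a′
  ; integerPart  = k
  ; nested = ≼-trans (≼-ceiling a p e) (≼-trans k≼ ≼a′) , ≼-trans a′+1≼ ≼a+1
  ; middle = ≼a′ , a′+1≼
  }
  where
  instance
    nonZero-3e : NonZero (3 * e)
    nonZero-3e = m*n≢0 3 e
  k : ℕ
  k = suc (a * e / p)
  a′ : ℕ
  a′ = suc ((1 + 3 * k) * p′ / (3 * e))

  ≼a′ : (1 + 3 * k , 3 * e) ≼ (a′ , p′)
  ≼a′ = ≼-ceiling (1 + 3 * k) (3 * e) p′

  a′+1≼ : (suc a′ , p′) ≼ (2 + 3 * k , 3 * e)
  a′+1≼ = ≼-ceiling-succ (1 + 3 * k) (3 * e) p′
            (≤-trans (≤-reflexive (sym (*-assoc 2 3 e))) p′≥6e)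

  k≼ : (k , e) ≼ (1 + 3 * k , 3 * e)
  k≼ = *≤* (≤-trans (m≤n+m (k * (3 * e)) e) (≤-reflexive (expand k e)))
    where
    expand : ∀ k e → e + k * (3 * e) ≡ (1 + 3 * k) * e
    expand = solve-∀

  kp≤ae+p : k * p ≤ a * e + p
  kp≤ae+p = begin
    p + a * e / p * p ≤⟨ +-monoʳ-≤ p (m/n*n≤m (a * e) p) ⟩
    p + a * e         ≡⟨ +-comm p (a * e) ⟩
    a * e + p         ∎

  ≼a+1 : (2 + 3 * k , 3 * e) ≼ (suc a , p)
  ≼a+1 = *≤* (begin
    (2 + 3 * k) * p       ≡⟨ expand₁ k p ⟩
    2 * p + 3 * (k * p)   ≤⟨ +-monoʳ-≤ (2 * p) (*-monoʳ-≤ 3 kp≤ae+p) ⟩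
    2 * p + 3 * (a * e + p) ≡⟨ expand₂ a e p ⟩
    5 * p + 3 * (a * e)   ≤⟨ +-monoˡ-≤ (3 * (a * e)) 3e≥5p ⟩
    3 * e + 3 * (a * e)   ≡⟨ expand₃ a e ⟩
    suc a * (3 * e)       ∎)
    where
    expand₁ : ∀ k p → (2 + 3 * k) * p ≡ 2 * p + 3 * (k * p)
    expand₁ = solve-∀
    expand₂ : ∀ a e p → 2 * p + 3 * (a * e + p) ≡ 5 * p + 3 * (a * e)
    expand₂ = solve-∀
    expand₃ : ∀ a e → 3 * e + 3 * (a * e) ≡ (1 + a) * (3 * e)
    expand₃ = solve-∀

FloorApprox : ℕ → ℕ → ℕ → Set
FloorApprox q y d = (q , 1) ≼ (y , d) × (y , d) ≺ (6 * q + 7 , 6)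

floorApprox : ∀ c {a p x d} .{{_ : NonZero p}} .{{_ : NonZero d}} →
              (x , d) ∈ cell a p → 6 * c ≤ p → FloorApprox (c * a / p) (c * x) d
floorApprox c {a} {p} (a≼x , x≼a+1) p≥6c =
  ≼-trans q≼ca (≼-scale c a≼x) , ≼-≺-trans (≼-scale c x≼a+1) ca+c≺
  where
  q : ℕ
  q = c * a / p

  q≼ca : (q , 1) ≼ (c * a , p)
  q≼ca = *≤* (≤-trans (m/n*n≤m (c * a) p) (≤-reflexive (sym (*-identityʳ (c * a)))))

  ca+c≺ : (c * suc a , p) ≺ (6 * q + 7 , 6)
  ca+c≺ = *<* (begin-strict
    c * suc a * 6       ≡⟨ expand₁ c a ⟩
    6 * (c * a) + 6 * c <⟨ +-mono-<-≤ (*-monoʳ-< 6 ([m/n+1]*n>m (c * a) p)) p≥6c ⟩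
    6 * (suc q * p) + p ≡⟨ expand₂ q p ⟩
    (6 * q + 7) * p     ∎)
    where
    expand₁ : ∀ c a → c * (1 + a) * 6 ≡ 6 * (c * a) + 6 * c
    expand₁ = solve-∀
    expand₂ : ∀ q p → 6 * ((1 + q) * p) + p ≡ (6 * q + 7) * p
    expand₂ = solve-∀

-- With α = x/d: q and q′ approximate cα and (c + 4e)α with error < 7/6, while
-- 4eα ∈ [4k + 4/3, 4k + 8/3]; so q′ − q lies strictly between 4k and 4k + 4.
floorApprox-gap : ∀ {q q′ c e k x d} .{{_ : NonZero d}} →
  FloorApprox q (c * x) d → FloorApprox q′ ((c + 4 * e) * x) d →
  (x , d) ∈ middleThird k e → q + 4 * k < q′ × q′ < q + 4 * k + 4
floorApprox-gap {q} {q′} {c} {e} {k} {x} {d}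
  (*≤* q≤ , *<* <q+7/6) (*≤* q′≤ , *<* <q′+7/6) (*≤* k+1/3≤ , *≤* ≤k+2/3) =
  *-cancelˡ-< 6 _ _ (*-cancelʳ-< d _ _ (+-cancelʳ-< (8 * d) _ _ lower)) ,
  *-cancelˡ-< 6 _ _ (*-cancelʳ-< d _ _ upper)
  where
  lower : 6 * (q + 4 * k) * d + 8 * d < 6 * q′ * d + 8 * d
  lower = begin-strict
    6 * (q + 4 * k) * d + 8 * d           ≡⟨ expand₁ q k d ⟩
    6 * (q * d) + 8 * ((1 + 3 * k) * d)   ≤⟨ +-mono-≤ (*-monoʳ-≤ 6 q≤) (*-monoʳ-≤ 8 k+1/3≤) ⟩
    6 * (c * x * 1) + 8 * (x * (3 * e))   ≡⟨ expand₂ c e x ⟩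
    (c + 4 * e) * x * 6                   <⟨ <q′+7/6 ⟩
    (6 * q′ + 7) * d                      ≤⟨ *-monoˡ-≤ d (+-monoʳ-≤ (6 * q′) (n≤1+n 7)) ⟩
    (6 * q′ + 8) * d                      ≡⟨ *-distribʳ-+ d (6 * q′) 8 ⟩
    6 * q′ * d + 8 * d                    ∎
    where
    expand₁ : ∀ q k d → 6 * (q + 4 * k) * d + 8 * d ≡ 6 * (q * d) + 8 * ((1 + 3 * k) * d)
    expand₁ = solve-∀
    expand₂ : ∀ c e x → 6 * (c * x * 1) + 8 * (x * (3 * e)) ≡ (c + 4 * e) * x * 6
    expand₂ = solve-∀

  upper : 6 * q′ * d < 6 * (q + 4 * k + 4) * d
  upper = begin-strict
    6 * q′ * d                              ≡⟨ *-assoc 6 q′ d ⟩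
    6 * (q′ * d)                            ≤⟨ *-monoʳ-≤ 6 q′≤ ⟩
    6 * ((c + 4 * e) * x * 1)               ≡⟨ expand₁ c e x ⟩
    c * x * 6 + 8 * (x * (3 * e))           <⟨ +-mono-<-≤ <q+7/6 (*-monoʳ-≤ 8 ≤k+2/3) ⟩
    (6 * q + 7) * d + 8 * ((2 + 3 * k) * d) ≡⟨ expand₂ q k d ⟩
    (6 * (q + 4 * k) + 23) * d              ≤⟨ *-monoˡ-≤ d (+-monoʳ-≤ (6 * (q + 4 * k)) (n≤1+n 23)) ⟩
    (6 * (q + 4 * k) + 24) * d              ≡⟨ cong (_* d) (expand₃ q k) ⟩
    6 * (q + 4 * k + 4) * d                 ∎
    where
    expand₁ : ∀ c e x → 6 * ((c + 4 * e) * x * 1) ≡ c * x * 6 + 8 * (x * (3 * e))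
    expand₁ = solve-∀
    expand₂ : ∀ q k d → (6 * q + 7) * d + 8 * ((2 + 3 * k) * d) ≡ (6 * (q + 4 * k) + 23) * d
    expand₂ = solve-∀
    expand₃ : ∀ q k → 6 * (q + 4 * k) + 24 ≡ 6 * (q + 4 * k + 4)
    expand₃ = solve-∀

[m+j]%n≢m%n : ∀ m {j n} .{{_ : NonZero n}} → 0 < j → j < n → (m + j) % n ≢ m % n
[m+j]%n≢m%n m {j} {n} 0<j j<n eq = <⇒≱ j<n (∣⇒≤ {{>-nonZero 0<j}} n∣j)
  where
  quotients : m / n * n + j ≡ (m + j) / n * n
  quotients = +-cancelˡ-≡ (m % n) _ _ (begin-equality
    m % n + (m / n * n + j)       ≡⟨ +-assoc (m % n) (m / n * n) j ⟨
    m % n + m / n * n + j         ≡⟨ cong (_+ j) (m≡m%n+[m/n]*n m n) ⟨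
    m + j                         ≡⟨ m≡m%n+[m/n]*n (m + j) n ⟩
    (m + j) % n + (m + j) / n * n ≡⟨ cong (_+ (m + j) / n * n) eq ⟩
    m % n + (m + j) / n * n       ∎)

  n∣j : n ∣ j
  n∣j = ∣m+n∣m⇒∣n (divides ((m + j) / n) quotients) (n∣m*n (m / n))

%-separated : ∀ {q q′ k n} .{{_ : NonZero n}} →
              q + n * k < q′ → q′ < q + n * k + n → q % n ≢ q′ % n
%-separated {q} {q′} {k} {n} lo hi eq =
  [m+j]%n≢m%n q (m<n⇒0<n∸m lo) j<n (begin-equality
    (q + j) % n         ≡⟨ [m+kn]%n≡m%n (q + j) k n ⟨
    (q + j + k * n) % n ≡⟨ cong (_% n) (trans (regroup q j k n) q+nk+j≡q′) ⟩
    q′ % n              ≡⟨ eq ⟨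
    q % n               ∎)
  where
  j : ℕ
  j = q′ ∸ (q + n * k)
  q+nk+j≡q′ : q + n * k + j ≡ q′
  q+nk+j≡q′ = m+[n∸m]≡n (<⇒≤ lo)
  j<n : j < n
  j<n = +-cancelˡ-< (q + n * k) j n (subst (_< q + n * k + n) (sym q+nk+j≡q′) hi)
  regroup : ∀ q j k n → q + j + k * n ≡ q + n * k + j
  regroup = solve-∀

AvoidsDifferences : {k : ℕ} → Colouring k → (ℕ → ℕ) → Set
AvoidsDifferences c D = ∀ n i → ¬ Monochromatic c n (n + D i)

-- The α of the argument is only approached through the nested cells C i;
-- the colour of n uses its approximation A n / P n, accurate enough because
-- P n ≥ 24 n.
module LacunaryColouring (E : ℕ → ℕ) (E₀≥2 : 2 ≤ E 0)
                         (growth : ∀ i → 10 * E i ≤ E (suc i)) where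

  E≥2 : ∀ i → 2 ≤ E i
  E≥2 zero    = E₀≥2
  E≥2 (suc i) = ≤-trans (E≥2 i) (≤-trans (m≤n*m (E i) 10) (growth i))

  instance
    E-nonZero : ∀ {i} → NonZero (E i)
    E-nonZero {i} = >-nonZero (≤-trans (s≤s z≤n) (E≥2 i))

  E≥4n : ∀ n → 4 * n ≤ E n
  E≥4n zero    = z≤n
  E≥4n (suc n) = begin
    4 * suc n       ≡⟨ *-suc 4 n ⟩
    4 + 4 * n       ≤⟨ +-mono-≤ (*-monoʳ-≤ 2 (E≥2 n)) (E≥4n n) ⟩
    2 * E n + E n   ≡⟨ +-comm (2 * E n) (E n) ⟩
    3 * E n         ≤⟨ *-monoˡ-≤ (E n) {3} {10} (s≤s (s≤s (s≤s z≤n))) ⟩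
    10 * E n        ≤⟨ growth n ⟩
    E (suc n)       ∎

  P : ℕ → ℕ
  P i = 6 * E i

  instance
    P-nonZero : ∀ {i} → NonZero (P i)
    P-nonZero {i} = m*n≢0 6 (E i)

  parentDen : ℕ → ℕ
  parentDen zero    = 1
  parentDen (suc i) = P i

  parentDen-nonZero : ∀ i → NonZero (parentDen i)
  parentDen-nonZero zero    = _
  parentDen-nonZero (suc i) = P-nonZero

  room : ∀ i → 5 * parentDen i ≤ 3 * E i
  room zero    = ≤-trans (n≤1+n 5) (*-monoʳ-≤ 3 E₀≥2)
  room (suc i) = begin
    5 * (6 * E i)  ≡⟨ regroup (E i) ⟩
    3 * (10 * E i) ≤⟨ *-monoʳ-≤ 3 (growth i) ⟩
    3 * E (suc i)  ∎
    where
    regroup : ∀ e → 5 * (6 * e) ≡ 3 * (10 * e)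
    regroup = solve-∀

  parentNum : ℕ → ℕ
  stage : ∀ i → Refinement (parentNum i) (parentDen i) (E i) (P i)

  parentNum zero    = 0
  parentNum (suc i) = Refinement.num (stage i)

  stage i = refine (parentNum i) (parentDen i) (E i) (P i) {{parentDen-nonZero i}}
                   ≤-refl (room i)

  A : ℕ → ℕ
  A i = Refinement.num (stage i)

  C : ℕ → Interval
  C i = cell (A i) (P i)

  C-antitone′ : ∀ {i j} → i ≤′ j → C j ⊆ C i
  C-antitone′ ≤′-refl        = ⊆-refl
  C-antitone′ (≤′-step i≤′j) = ⊆-trans (Refinement.nested (stage (suc _))) (C-antitone′ i≤′j)

  C-antitone : ∀ {i j} → i ≤ j → C j ⊆ C i
  C-antitone i≤j = C-antitone′ (≤⇒≤′ i≤j)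

  quarterDigit : ℕ → ℕ
  quarterDigit n = 4 * n * A n / P n

  colour : Colouring 4
  colour n = quarterDigit n mod 4

  colour-avoids : AvoidsDifferences colour E
  colour-avoids n i mono =
    %-separated {k = k} {n = 4} (proj₁ gap) (proj₂ gap) (begin-equality
      quarterDigit n % 4         ≡⟨ toℕ-fromℕ< (m%n<n (quarterDigit n) 4) ⟨
      toℕ (colour n)             ≡⟨ cong toℕ mono ⟩
      toℕ (colour (n + E i))     ≡⟨ toℕ-fromℕ< (m%n<n (quarterDigit (n + E i)) 4) ⟩
      quarterDigit (n + E i) % 4 ∎)
    where
    k : ℕ
    k = Refinement.integerPart (stage i)

    T : ℕ
    T = n + E i + i

    AT∈C : ∀ {j} → j ≤ T → (A T , P T) ∈ C j
    AT∈C j≤T = ∈-⊆ (lower∈cell (A T) (P T)) (C-antitone j≤T)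

    approx : ∀ m → m ≤ T → FloorApprox (quarterDigit m) (4 * m * A T) (P T)
    approx m m≤T = floorApprox (4 * m) (AT∈C m≤T) (*-monoʳ-≤ 6 (E≥4n m))

    approx′ : FloorApprox (quarterDigit (n + E i)) ((4 * n + 4 * E i) * A T) (P T)
    approx′ = subst (λ c → FloorApprox (quarterDigit (n + E i)) (c * A T) (P T))
                    (*-distribˡ-+ 4 n (E i)) (approx (n + E i) (m≤m+n (n + E i) i))

    gap : quarterDigit n + 4 * k < quarterDigit (n + E i) ×
          quarterDigit (n + E i) < quarterDigit n + 4 * k + 4
    gap = floorApprox-gap {c = 4 * n} {e = E i} {k = k}
            (approx n (≤-trans (m≤m+n n (E i)) (m≤m+n (n + E i) i))) approx′
            (∈-⊆ (AT∈C (m≤n+m i (n + E i))) (Refinement.middle (stage i)))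

productColouring : ∀ {k m} → (Fin m → Colouring k) → Colouring (k ^ m)
productColouring c n = funToFin (λ r → c r n)

productColouring-avoids : ∀ {k m} {D : Fin m → ℕ → ℕ} (c : Fin m → Colouring k) →
  (∀ r → AvoidsDifferences (c r) (D r)) → ∀ r → AvoidsDifferences (productColouring c) (D r)
productColouring-avoids {D = D} c avoids r n i mono = avoids r n i
  (trans (sym (finToFun-funToFin (λ r′ → c r′ n) r))
  (trans (cong (λ z → finToFun z r) mono)
         (finToFun-funToFin (λ r′ → c r′ (n + D r i)) r)))

residueClass : Fin 4 → ℕ → ℕ
residueClass r i = suc (toℕ r + i * 4)

residueClass-covers : ∀ u → ∃₂ λ r i → suc u ≡ residueClass r i
residueClass-covers u = remainder , quotient , cong suc property
  where open DivMod (u divMod 4)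

residueClass-suc : ∀ r i → residueClass r (suc i) ≡ 4 + residueClass r i
residueClass-suc r i = regroup (toℕ r) i
  where
  regroup : ∀ r i → suc (r + (1 + i) * 4) ≡ 4 + suc (r + i * 4)
  regroup = solve-∀

-- ⌊log₂ (b ^ b)⌋ for b = 2 ^ t.
log₂SelfPower : ℕ → ℕ
log₂SelfPower t = t * 2 ^ t

log₂SelfPower-suc≥2 : ∀ t → 2 ≤ log₂SelfPower (suc t)
log₂SelfPower-suc≥2 t = ≤-trans (*-monoʳ-≤ 2 (m^n>0 2 t)) (m≤n*m (2 ^ suc t) (suc t))

log₂SelfPower-growth : ∀ t → 10 * log₂SelfPower t ≤ log₂SelfPower (4 + t)
log₂SelfPower-growth t = begin
  10 * (t * 2 ^ t)       ≤⟨ *-monoˡ-≤ (t * 2 ^ t) {10} {16} (m≤m+n 10 6) ⟩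
  16 * (t * 2 ^ t)       ≤⟨ *-monoʳ-≤ 16 (*-monoˡ-≤ (2 ^ t) (m≤n+m t 4)) ⟩
  16 * ((4 + t) * 2 ^ t) ≡⟨ regroup (4 + t) (2 ^ t) ⟩
  (4 + t) * 2 ^ (4 + t)  ∎
  where
  regroup : ∀ t x → 16 * (t * x) ≡ t * (2 * (2 * (2 * (2 * x))))
  regroup = solve-∀

selfPowerGaps : Fin 4 → ℕ → ℕ
selfPowerGaps r i = log₂SelfPower (residueClass r i)

module SelfPowerColouring (r : Fin 4) = LacunaryColouring (selfPowerGaps r)
  (log₂SelfPower-suc≥2 (toℕ r + 0 * 4))
  (λ i → subst (λ t → 10 * selfPowerGaps r i ≤ log₂SelfPower t)
               (sym (residueClass-suc r i)) (log₂SelfPower-growth (residueClass r i)))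

χ : Colouring (4 ^ 4)
χ = productColouring SelfPowerColouring.colour

χ-avoids : ∀ n t → ¬ Monochromatic χ n (n + log₂SelfPower (suc t))
χ-avoids n t mono =
  productColouring-avoids SelfPowerColouring.colour SelfPowerColouring.colour-avoids r n i
    (subst (λ t → Monochromatic χ n (n + log₂SelfPower t)) t+1≡ mono)
  where
  r : Fin 4
  r = proj₁ (residueClass-covers t)
  i : ℕ
  i = proj₁ (proj₂ (residueClass-covers t))
  t+1≡ : suc t ≡ residueClass r i
  t+1≡ = proj₂ (proj₂ (residueClass-covers t))

⌊log₂[m*2^n]⌋ : ∀ m n .{{_ : NonZero m}} → ⌊log₂ (m * 2 ^ n) ⌋ ≡ ⌊log₂ m ⌋ + n
⌊log₂[m*2^n]⌋ m zero    = trans (cong ⌊log₂_⌋ (*-identityʳ m)) (sym (+-identityʳ _))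
⌊log₂[m*2^n]⌋ m (suc n) = begin-equality
  ⌊log₂ (m * (2 * 2 ^ n)) ⌋ ≡⟨ cong ⌊log₂_⌋ (x∙yz≈y∙xz m 2 (2 ^ n)) ⟩
  ⌊log₂ (2 * (m * 2 ^ n)) ⌋ ≡⟨ ⌊log₂[2*b]⌋≡1+⌊log₂b⌋ (m * 2 ^ n) {{m*n≢0 m (2 ^ n)}} ⟩
  suc ⌊log₂ (m * 2 ^ n) ⌋   ≡⟨ cong suc (⌊log₂[m*2^n]⌋ m n) ⟩
  suc (⌊log₂ m ⌋ + n)       ≡⟨ +-suc ⌊log₂ m ⌋ n ⟨
  ⌊log₂ m ⌋ + suc n         ∎
  where
  instance
    2^n≢0 : NonZero (2 ^ n)
    2^n≢0 = m^n≢0 2 n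

⌊log₂⌊log₂[2^s]^[b^b]⌋⌋ : ∀ s t →
  ⌊log₂ ⌊log₂ ((2 ^ suc s) ^ ((2 ^ t) ^ (2 ^ t))) ⌋ ⌋ ≡ ⌊log₂ suc s ⌋ + log₂SelfPower t
⌊log₂⌊log₂[2^s]^[b^b]⌋⌋ s t = begin-equality
  ⌊log₂ ⌊log₂ ((2 ^ suc s) ^ ((2 ^ t) ^ (2 ^ t))) ⌋ ⌋
    ≡⟨ cong (λ z → ⌊log₂ ⌊log₂ z ⌋ ⌋) (^-*-assoc 2 (suc s) ((2 ^ t) ^ (2 ^ t))) ⟩
  ⌊log₂ ⌊log₂ (2 ^ (suc s * (2 ^ t) ^ (2 ^ t))) ⌋ ⌋
    ≡⟨ cong ⌊log₂_⌋ (⌊log₂[2^n]⌋≡n (suc s * (2 ^ t) ^ (2 ^ t))) ⟩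
  ⌊log₂ (suc s * (2 ^ t) ^ (2 ^ t)) ⌋
    ≡⟨ cong (λ z → ⌊log₂ (suc s * z) ⌋) (^-*-assoc 2 t (2 ^ t)) ⟩
  ⌊log₂ (suc s * 2 ^ log₂SelfPower t) ⌋
    ≡⟨ ⌊log₂[m*2^n]⌋ (suc s) (log₂SelfPower t) ⟩
  ⌊log₂ suc s ⌋ + log₂SelfPower t
    ∎

proposition27 : Σ ℕ λ k → ∃ λ (c : Colouring k) → NoMonoPowerPair c
proposition27 = 4 ^ 4 , colouring , noPair
  where
  colouring : Colouring (4 ^ 4)
  colouring x = χ ⌊log₂ ⌊log₂ x ⌋ ⌋

  noPair : NoMonoPowerPair colouring
  noPair (suc s) (suc t) _ _ mono = χ-avoids ⌊log₂ suc s ⌋ t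
    (subst₂ (Monochromatic χ) (cong ⌊log₂_⌋ (⌊log₂[2^n]⌋≡n (suc s)))
            (⌊log₂⌊log₂[2^s]^[b^b]⌋⌋ s (suc t)) mono)
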